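{- Let $\mathbf{a}=(a_1,a_2,\ldots)$ and $\mathbf{e}=(e_1,e_2,\ldots)$ be arbitrary real sequences (both infinite, or both of the same finite length). Then for all $m\ge k\ge 0$ (within range) $$S^{\mathbf{a},\mathbf{e}}(m,k)=\sum_{\ell=0}^{m-k}(-1)^{\ell}\,h_{m-k-\ell}(a_1,\ldots,a_{k+1})\,s_{\ell}(e_1,\ldots,e_m).$$
   Context: The matrix entries $S^{\mathbf{a},\mathbf{e}}(m,k)$ are defined by the unique expansions $\prod_{i=1}^m(x-e_i)=\sum_{k=0}^m S^{\mathbf{a},\mathbf{e}}(m,k)\prod_{i=1}^k(x-a_i)$ for $m\ge0$. Here $h_\ell(x_1,\ldots,x_t)$ is the complete homogeneous symmetric polynomial of degree $\ell$ (sum of all degree-$\ell$ monomials, coefficient $1$) and $s_\ell(x_1,\ldots,x_t)$ is the elementary symmetric polynomial of degree $\ell$ (sum of all products of $\ell$ distinct variables); $h_0=s_0=1$. -}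

module Defs where

open import Level using (Level)
open import Algebra.Bundles using (CommutativeRing)
open import Data.Nat using (ℕ; zero; suc; _∸_)
open import Data.List using (List; []; _∷_; applyUpTo)

module _ {c ℓ : Level} (R : CommutativeRing c ℓ) where
  open CommutativeRing R using (Carrier; _≈_; _+_; _*_; -_; 0#; 1#)

  -- polynomials over R as coefficient lists, lowest degree first
  Poly : Set c
  Poly = List Carrier

  coeff : Poly → ℕ → Carrier
  coeff []       _       = 0#
  coeff (p ∷ ps) zero    = p
  coeff (p ∷ ps) (suc n) = coeff ps n

  _≋_ : Poly → Poly → Set ℓ
  p ≋ q = ∀ n → coeff p n ≈ coeff q n

  _⊕_ : Poly → Poly → Poly
  []       ⊕ q        = q
  (p ∷ ps) ⊕ []       = p ∷ ps
  (p ∷ ps) ⊕ (q ∷ qs) = (p + q) ∷ (ps ⊕ qs)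

  scale : Carrier → Poly → Poly
  scale c []       = []
  scale c (p ∷ ps) = (c * p) ∷ scale c ps

  mulLin : Carrier → Poly → Poly
  mulLin c p = (0# ∷ p) ⊕ scale (- c) p

  prodLin : List Carrier → Poly
  prodLin []       = 1# ∷ []
  prodLin (x ∷ xs) = mulLin x (prodLin xs)

  -- the list (u_1, …, u_n) of a 1-indexed sequence u : ℕ → R (u 0 unused)
  seg : (ℕ → Carrier) → ℕ → List Carrier
  seg u n = applyUpTo (λ i → u (suc i)) n

  pow : Carrier → ℕ → Carrier
  pow x zero    = 1#
  pow x (suc n) = x * pow x n

  sign : ℕ → Carrier
  sign zero    = 1#
  sign (suc n) = - sign n

  sumTo : ℕ → (ℕ → Carrier) → Carrier
  sumTo zero    f = f zero
  sumTo (suc n) f = sumTo n f + f (suc n)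

  -- complete homogeneous symmetric polynomial h_l(xs): sum of all degree-l
  -- monomials, enumerated by the exponent j of the first variable
  hc : ℕ → List Carrier → Carrier
  hc zero    []       = 1#
  hc (suc l) []       = 0#
  hc l       (x ∷ xs) = sumTo l (λ j → pow x j * hc (l ∸ j) xs)

  -- elementary symmetric polynomial s_l(xs): sum over l-subsets,
  -- split by whether the first variable is used
  se : ℕ → List Carrier → Carrier
  se zero    _        = 1#
  se (suc l) []       = 0#
  se (suc l) (x ∷ xs) = x * se l xs + se (suc l) xs

  formulaS : (a e : ℕ → Carrier) → ℕ → ℕ → Carrier
  formulaS a e m k =
    sumTo (m ∸ k) (λ l → sign l * (hc ((m ∸ k) ∸ l) (seg a (suc k)) * se l (seg e m)))

  newtonSum : (a : ℕ → Carrier) → ℕ → (ℕ → Carrier) → Poly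
  newtonSum a zero    T = scale (T zero) (prodLin (seg a zero))
  newtonSum a (suc m) T = newtonSum a m T ⊕ scale (T (suc m)) (prodLin (seg a (suc m)))

{-# OPTIONS --safe #-}
-- Induction on m, splitting off the factor X - e₁. The Newton basis N_k = ∏_{i ≤ k} (X - a_i) satisfies
-- (X - x) N_k = N_{k+1} + (a_{k+1} - x) N_k, so multiplying an expansion Σ_k T_k N_k by X - x yields the
-- expansion with coefficients T_{k-1} + (a_{k+1} - x) T_k. The claimed S(m+1, k) satisfy exactly this
-- recurrence in terms of the S(m, k) for (e₂, e₃, …): the sums Σ_l (-1)^l h_{d-l}(A) s_l(E) are the
-- coefficients of ∏_{e ∈ E} (1 - e t) / ∏_{a ∈ A} (1 - a t), which acquire a factor 1 - x t when x is
-- added to E and a factor 1 / (1 - y t) when y is added to A.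
module Submission where

open import Defs
open import Level using (Level)
open import Algebra.Bundles using (CommutativeRing)
open import Data.Nat using (ℕ; zero; suc; 2+; _∸_; _≤_; z≤n; s≤s)
open import Data.Nat.Properties using (≤-refl; ≤-reflexive; m≤n⇒m≤1+n; m≤n⇒m<n∨m≡n; +-∸-assoc; n∸n≡0)
open import Data.Sum using (inj₁; inj₂)
open import Data.List using (List; []; _∷_; _++_; length)
open import Data.List.Properties using (applyUpTo-∷ʳ; length-applyUpTo)
open import Data.Maybe using (nothing)
open import Function using (_∘_)
import Relation.Binary.PropositionalEquality as ≡
open import Tactic.RingSolver.Core.AlmostCommutativeRing using (fromCommutativeRing)
open import Tactic.RingSolver.Core.Expression using ()
  renaming (_⊕_ to _:+_; _⊗_ to _:*_; ⊝_ to :-_)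

module _ {c ℓ : Level} (R : CommutativeRing c ℓ) where
  open CommutativeRing R hiding (zero)
  import Algebra.Properties.CommutativeSemigroup +-commutativeSemigroup as +-Props
  import Algebra.Properties.CommutativeSemigroup *-commutativeSemigroup as *-Props
  open import Tactic.RingSolver.NonReflective (fromCommutativeRing R (λ _ → nothing)) using (solve; _⊜_)
  open import Relation.Binary.Reasoning.Setoid setoid

  sumTo-cong : ∀ d {f g : ℕ → Carrier} → (∀ l → l ≤ d → f l ≈ g l) → sumTo R d f ≈ sumTo R d g
  sumTo-cong zero    f≈g = f≈g 0 z≤n
  sumTo-cong (suc d) f≈g = +-cong (sumTo-cong d (λ l l≤d → f≈g l (m≤n⇒m≤1+n l≤d))) (f≈g (suc d) ≤-refl)

  sumTo-suc : ∀ d (f : ℕ → Carrier) → sumTo R (suc d) f ≈ f 0 + sumTo R d (f ∘ suc)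
  sumTo-suc zero    f = refl
  sumTo-suc (suc d) f = trans (+-congʳ (sumTo-suc d f)) (+-assoc _ _ _)

  sumTo-+ : ∀ d (f g : ℕ → Carrier) → sumTo R d (λ l → f l + g l) ≈ sumTo R d f + sumTo R d g
  sumTo-+ zero    f g = refl
  sumTo-+ (suc d) f g = trans (+-congʳ (sumTo-+ d f g)) (+-Props.interchange _ _ _ _)

  *-distribˡ-sumTo : ∀ d x (f : ℕ → Carrier) → x * sumTo R d f ≈ sumTo R d (λ l → x * f l)
  *-distribˡ-sumTo zero    x f = refl
  *-distribˡ-sumTo (suc d) x f = trans (distribˡ x _ _) (+-congʳ (*-distribˡ-sumTo d x f))

  sumTo-zero : ∀ d (f : ℕ → Carrier) → (∀ l → l ≤ d → f l ≈ 0#) → sumTo R d f ≈ 0#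
  sumTo-zero d f f≈0 = trans (sumTo-cong d f≈0) (sumTo-const-0 d)
    where
    sumTo-const-0 : ∀ d → sumTo R d (λ _ → 0#) ≈ 0#
    sumTo-const-0 zero    = refl
    sumTo-const-0 (suc d) = trans (+-identityʳ _) (sumTo-const-0 d)

  shift : (ℕ → Carrier) → ℕ → Carrier
  shift f zero    = 0#
  shift f (suc n) = f n

  shift-cong : ∀ {f g : ℕ → Carrier} → (∀ n → f n ≈ g n) → ∀ n → shift f n ≈ shift g n
  shift-cong f≈g zero    = refl
  shift-cong f≈g (suc n) = f≈g n

  shift-sumTo : ∀ m (T : ℕ → Carrier) (B : ℕ → ℕ → Carrier) n →
    shift (λ n → sumTo R m (λ k → T k * B k n)) n ≈ sumTo R m (λ k → T k * shift (B k) n)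
  shift-sumTo m T B zero    = sym (sumTo-zero m (λ k → T k * 0#) (λ k _ → zeroʳ (T k)))
  shift-sumTo m T B (suc n) = refl

  sumTo-shift : ∀ m (T B : ℕ → Carrier) →
    sumTo R m (λ k → T k * B (suc k)) ≈ sumTo R m (λ k → shift T k * B k) + T m * B (suc m)
  sumTo-shift zero    T B = sym (trans (+-congʳ (zeroˡ (B 0))) (+-identityˡ _))
  sumTo-shift (suc m) T B = +-congʳ (sumTo-shift m T B)

  coeff-⊕ : ∀ p q n → coeff R (_⊕_ R p q) n ≈ coeff R p n + coeff R q n
  coeff-⊕ []      q       n       = sym (+-identityˡ _)
  coeff-⊕ (x ∷ p) []      n       = sym (+-identityʳ _)
  coeff-⊕ (x ∷ p) (y ∷ q) zero    = refl
  coeff-⊕ (x ∷ p) (y ∷ q) (suc n) = coeff-⊕ p q n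

  coeff-scale : ∀ x p n → coeff R (scale R x p) n ≈ x * coeff R p n
  coeff-scale x []      n       = sym (zeroʳ x)
  coeff-scale x (y ∷ p) zero    = refl
  coeff-scale x (y ∷ p) (suc n) = coeff-scale x p n

  coeff-0∷ : ∀ p n → coeff R (0# ∷ p) n ≈ shift (coeff R p) n
  coeff-0∷ p zero    = refl
  coeff-0∷ p (suc n) = refl

  coeff-mulLin : ∀ x p n → coeff R (mulLin R x p) n ≈ shift (coeff R p) n + - x * coeff R p n
  coeff-mulLin x p n =
    trans (coeff-⊕ (0# ∷ p) (scale R (- x) p) n) (+-cong (coeff-0∷ p n) (coeff-scale (- x) p n))

  shift-coeff-mulLin : ∀ x p n →
    shift (coeff R (mulLin R x p)) n ≈ shift (shift (coeff R p)) n + - x * shift (coeff R p) n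
  shift-coeff-mulLin x p zero    = sym (trans (+-identityˡ _) (zeroʳ _))
  shift-coeff-mulLin x p (suc n) = coeff-mulLin x p n

  mulLin-cong : ∀ x p q → _≋_ R p q → _≋_ R (mulLin R x p) (mulLin R x q)
  mulLin-cong x p q p≋q n = begin
    coeff R (mulLin R x p) n                     ≈⟨ coeff-mulLin x p n ⟩
    shift (coeff R p) n + - x * coeff R p n      ≈⟨ +-cong (shift-cong p≋q n) (*-congˡ (p≋q n)) ⟩
    shift (coeff R q) n + - x * coeff R q n      ≈⟨ coeff-mulLin x q n ⟨
    coeff R (mulLin R x q) n                     ∎

  mulLin-comm : ∀ x y p → _≋_ R (mulLin R x (mulLin R y p)) (mulLin R y (mulLin R x p))
  mulLin-comm x y p n = begin
    coeff R (mulLin R x (mulLin R y p)) n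
      ≈⟨ coeff-mulLin x (mulLin R y p) n ⟩
    shift (coeff R (mulLin R y p)) n + - x * coeff R (mulLin R y p) n
      ≈⟨ +-cong (shift-coeff-mulLin y p n) (*-congˡ (coeff-mulLin y p n)) ⟩
    (p₂ + - y * p₁) + - x * (p₁ + - y * p₀)
      ≈⟨ solve 5 (λ p₂ p₁ x y p₀ → ((p₂ :+ (:- y) :* p₁) :+ (:- x) :* (p₁ :+ (:- y) :* p₀))
                                 ⊜ ((p₂ :+ (:- x) :* p₁) :+ (:- y) :* (p₁ :+ (:- x) :* p₀)))
                 refl p₂ p₁ x y p₀ ⟩
    (p₂ + - x * p₁) + - y * (p₁ + - x * p₀)
      ≈⟨ +-cong (shift-coeff-mulLin x p n) (*-congˡ (coeff-mulLin x p n)) ⟨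
    shift (coeff R (mulLin R x p)) n + - y * coeff R (mulLin R x p) n
      ≈⟨ coeff-mulLin y (mulLin R x p) n ⟨
    coeff R (mulLin R y (mulLin R x p)) n
      ∎
    where
    p₀ p₁ p₂ : Carrier
    p₀ = coeff R p n
    p₁ = shift (coeff R p) n
    p₂ = shift (shift (coeff R p)) n

  prodLin-snoc : ∀ xs y → _≋_ R (prodLin R (xs ++ y ∷ [])) (mulLin R y (prodLin R xs))
  prodLin-snoc []       y n = refl
  prodLin-snoc (x ∷ xs) y n =
    trans (mulLin-cong x (prodLin R (xs ++ y ∷ [])) (mulLin R y (prodLin R xs)) (prodLin-snoc xs y) n)
          (mulLin-comm x y (prodLin R xs) n)

  module _ (a : ℕ → Carrier) where
    newtonBasis : ℕ → ℕ → Carrier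
    newtonBasis k = coeff R (prodLin R (seg R a k))

    seg-suc : ∀ k → seg R a (suc k) ≡.≡ seg R a k ++ a (suc k) ∷ []
    seg-suc k = ≡.sym (applyUpTo-∷ʳ (λ i → a (suc i)) k)

    newtonBasis-suc : ∀ k n →
      newtonBasis (suc k) n ≈ shift (newtonBasis k) n + - a (suc k) * newtonBasis k n
    newtonBasis-suc k n = begin
      newtonBasis (suc k) n
        ≡⟨ ≡.cong (λ xs → coeff R (prodLin R xs) n) (seg-suc k) ⟩
      coeff R (prodLin R (seg R a k ++ a (suc k) ∷ [])) n
        ≈⟨ prodLin-snoc (seg R a k) (a (suc k)) n ⟩
      coeff R (mulLin R (a (suc k)) (prodLin R (seg R a k))) n
        ≈⟨ coeff-mulLin (a (suc k)) (prodLin R (seg R a k)) n ⟩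
      shift (newtonBasis k) n + - a (suc k) * newtonBasis k n ∎

    shift-newtonBasis : ∀ k n →
      shift (newtonBasis k) n ≈ newtonBasis (suc k) n + a (suc k) * newtonBasis k n
    shift-newtonBasis k n = sym (begin
      newtonBasis (suc k) n + a (suc k) * newtonBasis k n
        ≈⟨ +-congʳ (newtonBasis-suc k n) ⟩
      (shift (newtonBasis k) n + - a (suc k) * newtonBasis k n) + a (suc k) * newtonBasis k n
        ≈⟨ +-assoc _ _ _ ⟩
      shift (newtonBasis k) n + (- a (suc k) * newtonBasis k n + a (suc k) * newtonBasis k n)
        ≈⟨ +-congˡ (trans (sym (distribʳ _ _ _)) (trans (*-congʳ (-‿inverseˡ _)) (zeroˡ _))) ⟩
      shift (newtonBasis k) n + 0#
        ≈⟨ +-identityʳ _ ⟩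
      shift (newtonBasis k) n ∎)

    coeff-newtonSum : ∀ m T n → coeff R (newtonSum R a m T) n ≈ sumTo R m (λ k → T k * newtonBasis k n)
    coeff-newtonSum zero    T n = coeff-scale (T 0) (prodLin R []) n
    coeff-newtonSum (suc m) T n =
      trans (coeff-⊕ (newtonSum R a m T) (scale R (T (suc m)) (prodLin R (seg R a (suc m)))) n)
            (+-cong (coeff-newtonSum m T n) (coeff-scale (T (suc m)) (prodLin R (seg R a (suc m))) n))

    prodLin-[]≋newtonSum-zero : ∀ T → T 0 ≈ 1# → _≋_ R (prodLin R []) (newtonSum R a 0 T)
    prodLin-[]≋newtonSum-zero T T₀≈1 n =
      sym (trans (coeff-newtonSum 0 T n) (trans (*-congʳ T₀≈1) (*-identityˡ _)))

    shift-newtonSum : ∀ m T n →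
      shift (coeff R (newtonSum R a m T)) n
        ≈ sumTo R m (λ k → (shift T k + a (suc k) * T k) * newtonBasis k n) + T m * newtonBasis (suc m) n
    shift-newtonSum m T n = begin
      shift (coeff R (newtonSum R a m T)) n
        ≈⟨ shift-cong (coeff-newtonSum m T) n ⟩
      shift (λ n → sumTo R m (λ k → T k * newtonBasis k n)) n
        ≈⟨ shift-sumTo m T newtonBasis n ⟩
      sumTo R m (λ k → T k * shift (newtonBasis k) n)
        ≈⟨ sumTo-cong m (λ k _ → trans (*-congˡ (shift-newtonBasis k n)) (distribˡ _ _ _)) ⟩
      sumTo R m (λ k → T k * newtonBasis (suc k) n + T k * (a (suc k) * newtonBasis k n))
        ≈⟨ sumTo-+ m _ _ ⟩
      sumTo R m (λ k → T k * newtonBasis (suc k) n)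
        + sumTo R m (λ k → T k * (a (suc k) * newtonBasis k n))
        ≈⟨ +-congʳ (sumTo-shift m T (λ k → newtonBasis k n)) ⟩
      (sumTo R m (λ k → shift T k * newtonBasis k n) + T m * newtonBasis (suc m) n)
        + sumTo R m (λ k → T k * (a (suc k) * newtonBasis k n))
        ≈⟨ +-Props.xy∙z≈xz∙y _ _ _ ⟩
      (sumTo R m (λ k → shift T k * newtonBasis k n)
        + sumTo R m (λ k → T k * (a (suc k) * newtonBasis k n)))
        + T m * newtonBasis (suc m) n
        ≈⟨ +-congʳ (trans (sym (sumTo-+ m _ _)) (sumTo-cong m (λ k _ → collect k))) ⟩
      sumTo R m (λ k → (shift T k + a (suc k) * T k) * newtonBasis k n) + T m * newtonBasis (suc m) n ∎
      where
      collect : ∀ k → shift T k * newtonBasis k n + T k * (a (suc k) * newtonBasis k n)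
                        ≈ (shift T k + a (suc k) * T k) * newtonBasis k n
      collect k = sym (trans (distribʳ _ _ _)
        (+-congˡ (trans (*-assoc _ _ _) (*-Props.x∙yz≈y∙xz _ _ _))))

    mulLin-newtonSum : ∀ x m (T U : ℕ → Carrier) →
      (∀ k → k ≤ m → U k ≈ shift T k + (a (suc k) - x) * T k) → U (suc m) ≈ T m →
      _≋_ R (mulLin R x (newtonSum R a m T)) (newtonSum R a (suc m) U)
    mulLin-newtonSum x m T U U≈ U-top n = begin
      coeff R (mulLin R x (newtonSum R a m T)) n
        ≈⟨ coeff-mulLin x (newtonSum R a m T) n ⟩
      shift (coeff R (newtonSum R a m T)) n + - x * coeff R (newtonSum R a m T) n
        ≈⟨ +-cong (shift-newtonSum m T n)
                  (trans (*-congˡ (coeff-newtonSum m T n)) (*-distribˡ-sumTo m (- x) _)) ⟩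
      (sumTo R m (λ k → (shift T k + a (suc k) * T k) * newtonBasis k n) + T m * newtonBasis (suc m) n)
        + sumTo R m (λ k → - x * (T k * newtonBasis k n))
        ≈⟨ +-Props.xy∙z≈xz∙y _ _ _ ⟩
      (sumTo R m (λ k → (shift T k + a (suc k) * T k) * newtonBasis k n)
        + sumTo R m (λ k → - x * (T k * newtonBasis k n))) + T m * newtonBasis (suc m) n
        ≈⟨ +-cong (trans (sym (sumTo-+ m _ _)) (sumTo-cong m collect)) (*-congʳ (sym U-top)) ⟩
      sumTo R m (λ k → U k * newtonBasis k n) + U (suc m) * newtonBasis (suc m) n
        ≈⟨ coeff-newtonSum (suc m) U n ⟨
      coeff R (newtonSum R a (suc m) U) n ∎
      where
      collect : ∀ k → k ≤ m →
        (shift T k + a (suc k) * T k) * newtonBasis k n + - x * (T k * newtonBasis k n)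
          ≈ U k * newtonBasis k n
      collect k k≤m = begin
        (shift T k + a (suc k) * T k) * newtonBasis k n + - x * (T k * newtonBasis k n)
          ≈⟨ +-congˡ (*-assoc _ _ _) ⟨
        (shift T k + a (suc k) * T k) * newtonBasis k n + (- x * T k) * newtonBasis k n
          ≈⟨ distribʳ _ _ _ ⟨
        ((shift T k + a (suc k) * T k) + - x * T k) * newtonBasis k n
          ≈⟨ *-congʳ (trans (+-congˡ (distribʳ _ _ _)) (sym (+-assoc _ _ _))) ⟨
        (shift T k + (a (suc k) - x) * T k) * newtonBasis k n
          ≈⟨ *-congʳ (U≈ k k≤m) ⟨
        U k * newtonBasis k n ∎

  hc-∷ : ∀ n x xs → hc R n (x ∷ xs) ≡.≡ sumTo R n (λ j → pow R x j * hc R (n ∸ j) xs)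
  hc-∷ zero    x xs = ≡.refl
  hc-∷ (suc n) x xs = ≡.refl

  hc-zero : ∀ xs → hc R 0 xs ≈ 1#
  hc-zero []       = refl
  hc-zero (x ∷ xs) = trans (*-identityˡ _) (hc-zero xs)

  hc-suc-∷ : ∀ n x xs → hc R (suc n) (x ∷ xs) ≈ x * hc R n (x ∷ xs) + hc R (suc n) xs
  hc-suc-∷ n x xs = begin
    hc R (suc n) (x ∷ xs)
      ≈⟨ sumTo-suc n _ ⟩
    1# * hc R (suc n) xs + sumTo R n (λ j → (x * pow R x j) * hc R (n ∸ j) xs)
      ≈⟨ +-cong (*-identityˡ _)
                (trans (sumTo-cong n (λ j _ → *-assoc _ _ _)) (sym (*-distribˡ-sumTo n x _))) ⟩
    hc R (suc n) xs + x * sumTo R n (λ j → pow R x j * hc R (n ∸ j) xs)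
      ≡⟨ ≡.cong (λ h → hc R (suc n) xs + x * h) (hc-∷ n x xs) ⟨
    hc R (suc n) xs + x * hc R n (x ∷ xs)
      ≈⟨ +-comm _ _ ⟩
    x * hc R n (x ∷ xs) + hc R (suc n) xs ∎

  hc-snoc : ∀ n xs y → hc R (suc n) (xs ++ y ∷ []) ≈ hc R (suc n) xs + y * hc R n (xs ++ y ∷ [])
  hc-snoc n       []       y = trans (hc-suc-∷ n y []) (+-comm _ _)
  hc-snoc zero    (x ∷ xs) y = begin
    hc R 1 (x ∷ xs ++ y ∷ [])
      ≈⟨ hc-suc-∷ 0 x (xs ++ y ∷ []) ⟩
    x * hc R 0 (x ∷ xs ++ y ∷ []) + hc R 1 (xs ++ y ∷ [])
      ≈⟨ +-cong (*-congˡ (hc-zero-cong (x ∷ xs ++ y ∷ []) (x ∷ xs))) (hc-snoc 0 xs y) ⟩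
    x * hc R 0 (x ∷ xs) + (hc R 1 xs + y * hc R 0 (xs ++ y ∷ []))
      ≈⟨ +-assoc _ _ _ ⟨
    (x * hc R 0 (x ∷ xs) + hc R 1 xs) + y * hc R 0 (xs ++ y ∷ [])
      ≈⟨ +-cong (hc-suc-∷ 0 x xs) (*-congˡ (hc-zero-cong (x ∷ xs ++ y ∷ []) (xs ++ y ∷ []))) ⟨
    hc R 1 (x ∷ xs) + y * hc R 0 (x ∷ xs ++ y ∷ []) ∎
    where
    hc-zero-cong : ∀ xs ys → hc R 0 xs ≈ hc R 0 ys
    hc-zero-cong xs ys = trans (hc-zero xs) (sym (hc-zero ys))
  hc-snoc (suc n) (x ∷ xs) y = begin
    hc R (2+ n) (x ∷ xs ++ y ∷ [])
      ≈⟨ hc-suc-∷ (suc n) x (xs ++ y ∷ []) ⟩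
    x * hc R (suc n) (x ∷ xs ++ y ∷ []) + hc R (2+ n) (xs ++ y ∷ [])
      ≈⟨ +-cong (*-congˡ (hc-snoc n (x ∷ xs) y)) (hc-snoc (suc n) xs y) ⟩
    x * (hc R (suc n) (x ∷ xs) + y * P) + (hc R (2+ n) xs + y * Q)
      ≈⟨ solve 6 (λ x y h P h′ Q → (x :* (h :+ y :* P) :+ (h′ :+ y :* Q))
                                  ⊜ ((x :* h :+ h′) :+ y :* (x :* P :+ Q)))
                 refl x y (hc R (suc n) (x ∷ xs)) P (hc R (2+ n) xs) Q ⟩
    (x * hc R (suc n) (x ∷ xs) + hc R (2+ n) xs) + y * (x * P + Q)
      ≈⟨ +-cong (hc-suc-∷ (suc n) x xs) (*-congˡ (hc-suc-∷ n x (xs ++ y ∷ []))) ⟨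
    hc R (2+ n) (x ∷ xs) + y * hc R (suc n) (x ∷ xs ++ y ∷ []) ∎
    where
    P Q : Carrier
    P = hc R n (x ∷ xs ++ y ∷ [])
    Q = hc R (suc n) (xs ++ y ∷ [])

  se-vanish : ∀ l xs → length xs ≤ l → se R (suc l) xs ≈ 0#
  se-vanish l       []       _         = refl
  se-vanish (suc l) (x ∷ xs) (s≤s len≤l) =
    trans (+-cong (trans (*-congˡ (se-vanish l xs len≤l)) (zeroʳ x))
                  (se-vanish (suc l) xs (m≤n⇒m≤1+n len≤l)))
          (+-identityʳ 0#)

  -- superH d A E is the coefficient of t^d in ∏_{e ∈ E} (1 - e t) / ∏_{a ∈ A} (1 - a t)
  superH : ℕ → List Carrier → List Carrier → Carrier
  superH d A E = sumTo R d (λ l → sign R l * (hc R (d ∸ l) A * se R l E))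

  superH-zero : ∀ A E → superH 0 A E ≈ 1#
  superH-zero A E = trans (*-identityˡ _) (trans (*-identityʳ _) (hc-zero A))

  superH-∷ : ∀ d A x E → superH (suc d) A (x ∷ E) ≈ superH (suc d) A E + - x * superH d A E
  superH-∷ d A x E = begin
    superH (suc d) A (x ∷ E)
      ≈⟨ sumTo-suc d f ⟩
    f 0 + sumTo R d (f ∘ suc)
      ≈⟨ +-congˡ (sumTo-cong d (λ l _ → split l)) ⟩
    g 0 + sumTo R d (λ l → g (suc l) + - x * k l)
      ≈⟨ +-congˡ (trans (sumTo-+ d (g ∘ suc) _) (+-congˡ (sym (*-distribˡ-sumTo d (- x) k)))) ⟩
    g 0 + (sumTo R d (g ∘ suc) + - x * superH d A E)
      ≈⟨ +-assoc _ _ _ ⟨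
    (g 0 + sumTo R d (g ∘ suc)) + - x * superH d A E
      ≈⟨ +-congʳ (sumTo-suc d g) ⟨
    superH (suc d) A E + - x * superH d A E ∎
    where
    f g k : ℕ → Carrier
    f l = sign R l * (hc R (suc d ∸ l) A * se R l (x ∷ E))
    g l = sign R l * (hc R (suc d ∸ l) A * se R l E)
    k l = sign R l * (hc R (d ∸ l) A * se R l E)
    split : ∀ l → f (suc l) ≈ g (suc l) + - x * k l
    split l = solve 5 (λ s h x u v → ((:- s) :* (h :* (x :* u :+ v)))
                                  ⊜ ((:- s) :* (h :* v) :+ (:- x) :* (s :* (h :* u))))
      refl (sign R l) (hc R (d ∸ l) A) x (se R l E) (se R (suc l) E)

  superH-snoc : ∀ d A y E →
    superH (suc d) (A ++ y ∷ []) E ≈ superH (suc d) A E + y * superH d (A ++ y ∷ []) E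
  superH-snoc d A y E = begin
    sumTo R d f + f (suc d)
      ≈⟨ +-cong (trans (sumTo-cong d split) (sumTo-+ d g _)) top ⟩
    (sumTo R d g + sumTo R d (λ l → y * k l)) + g (suc d)
      ≈⟨ +-Props.xy∙z≈xz∙y _ _ _ ⟩
    (sumTo R d g + g (suc d)) + sumTo R d (λ l → y * k l)
      ≈⟨ +-congˡ (*-distribˡ-sumTo d y k) ⟨
    superH (suc d) A E + y * superH d (A ++ y ∷ []) E ∎
    where
    A′ = A ++ y ∷ []
    f g k : ℕ → Carrier
    f l = sign R l * (hc R (suc d ∸ l) A′ * se R l E)
    g l = sign R l * (hc R (suc d ∸ l) A * se R l E)
    k l = sign R l * (hc R (d ∸ l) A′ * se R l E)
    top : f (suc d) ≈ g (suc d)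
    top = *-congˡ (*-congʳ (trans (hc-zero′ A′) (sym (hc-zero′ A))))
      where
      hc-zero′ : ∀ B → hc R (d ∸ d) B ≈ 1#
      hc-zero′ B = trans (reflexive (≡.cong (λ j → hc R j B) (n∸n≡0 d))) (hc-zero B)
    split : ∀ l → l ≤ d → f l ≈ g l + y * k l
    split l l≤d = begin
      sign R l * (hc R (suc d ∸ l) A′ * se R l E)
        ≡⟨ ≡.cong (λ j → sign R l * (hc R j A′ * se R l E)) (+-∸-assoc 1 l≤d) ⟩
      sign R l * (hc R (suc (d ∸ l)) A′ * se R l E)
        ≈⟨ *-congˡ (*-congʳ (hc-snoc (d ∸ l) A y)) ⟩
      sign R l * ((hc R (suc (d ∸ l)) A + y * hc R (d ∸ l) A′) * se R l E)
        ≈⟨ trans (*-congˡ (distribʳ _ _ _)) (distribˡ _ _ _) ⟩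
      sign R l * (hc R (suc (d ∸ l)) A * se R l E) + sign R l * ((y * hc R (d ∸ l) A′) * se R l E)
        ≈⟨ +-congˡ (trans (*-congˡ (*-assoc _ _ _)) (*-Props.x∙yz≈y∙xz _ _ _)) ⟩
      sign R l * (hc R (suc (d ∸ l)) A * se R l E) + y * k l
        ≡⟨ ≡.cong (λ j → sign R l * (hc R j A * se R l E) + y * k l) (+-∸-assoc 1 l≤d) ⟨
      g l + y * k l ∎

  superH-[] : ∀ d E → length E ≤ d → superH (suc d) [] E ≈ 0#
  superH-[] d E len≤d = sumTo-zero (suc d) _ vanish
    where
    vanish : ∀ l → l ≤ suc d → sign R l * (hc R (suc d ∸ l) [] * se R l E) ≈ 0#
    vanish l l≤1+d with m≤n⇒m<n∨m≡n l≤1+d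
    ... | inj₁ (s≤s l≤d) = trans (*-congˡ (trans (*-congʳ hc≈0) (zeroˡ _))) (zeroʳ _)
      where
      hc≈0 : hc R (suc d ∸ l) [] ≈ 0#
      hc≈0 = reflexive (≡.cong (λ j → hc R j []) (+-∸-assoc 1 l≤d))
    ... | inj₂ ≡.refl    = trans (*-congˡ (trans (*-congˡ (se-vanish d E len≤d)) (zeroʳ _))) (zeroʳ _)

  superH-snoc-∷ : ∀ d A y x E →
    superH (suc d) (A ++ y ∷ []) (x ∷ E) ≈ superH (suc d) A E + (y - x) * superH d (A ++ y ∷ []) E
  superH-snoc-∷ d A y x E = begin
    superH (suc d) (A ++ y ∷ []) (x ∷ E)
      ≈⟨ superH-∷ d (A ++ y ∷ []) x E ⟩
    superH (suc d) (A ++ y ∷ []) E + - x * superH d (A ++ y ∷ []) E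
      ≈⟨ +-congʳ (superH-snoc d A y E) ⟩
    (superH (suc d) A E + y * superH d (A ++ y ∷ []) E) + - x * superH d (A ++ y ∷ []) E
      ≈⟨ trans (+-assoc _ _ _) (+-congˡ (sym (distribʳ _ _ _))) ⟩
    superH (suc d) A E + (y - x) * superH d (A ++ y ∷ []) E ∎

  formulaS-diag : ∀ a e m → formulaS R a e m m ≈ 1#
  formulaS-diag a e m = begin
    superH (m ∸ m) A E ≡⟨ ≡.cong (λ d → superH d A E) (n∸n≡0 m) ⟩
    superH 0 A E       ≈⟨ superH-zero A E ⟩
    1#                 ∎
    where
    A = seg R a (suc m)
    E = seg R e m

  formulaS-step : ∀ a e m k → k ≤ m →
    formulaS R a e (suc m) k
      ≈ shift (formulaS R a (e ∘ suc) m) k + (a (suc k) - e 1) * formulaS R a (e ∘ suc) m k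
  formulaS-step a e m k k≤m = begin
    superH (suc m ∸ k) (seg R a (suc k)) (e 1 ∷ E)
      ≡⟨ ≡.cong (λ d → superH d (seg R a (suc k)) (e 1 ∷ E)) (+-∸-assoc 1 k≤m) ⟩
    superH (suc (m ∸ k)) (seg R a (suc k)) (e 1 ∷ E)
      ≈⟨ peel-e₁ ⟩
    superH (suc (m ∸ k)) (seg R a k) E + (a (suc k) - e 1) * T k
      ≈⟨ +-congʳ (superH≈shift k k≤m) ⟩
    shift T k + (a (suc k) - e 1) * T k ∎
    where
    E = seg R (e ∘ suc) m
    T = formulaS R a (e ∘ suc) m
    peel-e₁ : superH (suc (m ∸ k)) (seg R a (suc k)) (e 1 ∷ E)
                ≈ superH (suc (m ∸ k)) (seg R a k) E + (a (suc k) - e 1) * T k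
    peel-e₁ rewrite seg-suc a k = superH-snoc-∷ (m ∸ k) (seg R a k) (a (suc k)) (e 1) E
    superH≈shift : ∀ i → i ≤ m → superH (suc (m ∸ i)) (seg R a i) E ≈ shift T i
    superH≈shift zero    _   = superH-[] m E (≤-reflexive (length-applyUpTo _ m))
    superH≈shift (suc j) j<m =
      reflexive (≡.cong (λ d → superH d (seg R a (suc j)) E) (≡.sym (+-∸-assoc 1 j<m)))

lemma3p2 : {c ℓ : Level} (R : CommutativeRing c ℓ) (a e : ℕ → CommutativeRing.Carrier R) (m : ℕ) →
    _≋_ R (prodLin R (seg R e m)) (newtonSum R a m (formulaS R a e m))
lemma3p2 R a e zero      = prodLin-[]≋newtonSum-zero R a (formulaS R a e 0) (formulaS-diag R a e 0)
lemma3p2 R a e (suc m) n =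
  trans (mulLin-cong R (e 1) (prodLin R (seg R (e ∘ suc) m)) (newtonSum R a m T)
                     (lemma3p2 R a (e ∘ suc) m) n)
        (mulLin-newtonSum R a (e 1) m T U (formulaS-step R a e m) U-top n)
  where
  open CommutativeRing R using (_≈_; trans; sym)
  T U : ℕ → CommutativeRing.Carrier R
  T = formulaS R a (e ∘ suc) m
  U = formulaS R a e (suc m)
  U-top : U (suc m) ≈ T m
  U-top = trans (formulaS-diag R a e (suc m)) (sym (formulaS-diag R a (e ∘ suc) m))
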